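{- For every integer $l\ge 1$ there exists an integer $B$ with the following property. Let $L$ be a horizontal line of the unit square grid, and call the unit squares lying on one fixed side of $L$ and having an edge on $L$ the boundary squares. Then any collection of pairwise non-overlapping T-tetrominos, each lying entirely on that side of $L$, which covers $B$ consecutive boundary squares contains an arithmetic progression of tiles of length $l$.
   Context: A T-tetromino is the polyomino consisting of four unit grid squares arranged as a row of three squares together with one square attached to the middle square of that row; tiles are placed with their squares on the unit square grid. Two tiles are in the same orientation if one is a translate of the other. An arithmetic progression (AP) of tiles of length $l$ is a sequence $T_1,\dots,T_l$ of distinct tiles, all in the same orientation, such that the translation vector carrying $T_i$ to $T_{i+1}$ is the same for all $1\le i\le l-1$. -}

module Defs where

open import Data.Nat using (ℕ; suc; _<_)
open import Data.Integer using (ℤ; _+_; _-_; _*_; +_; _≤_; _<_)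
open import Data.Product using (_×_; _,_; Σ; ∃; ∃-syntax)
open import Data.List using (List; []; _∷_; map)
open import Data.List.Membership.Propositional using (_∈_)
open import Relation.Binary.PropositionalEquality using (_≡_)
open import Relation.Nullary using (¬_)

-- A cell (x , y) is the unit square [x, x+1] × [y, y+1] of the grid.
Cell : Set
Cell = ℤ × ℤ

_⊕_ : Cell → Cell → Cell
(a , b) ⊕ (c , d) = (a + c , b + d)

-- The four orientations of the T-tetromino, named by the direction in which
-- the single extra square sticks out from the middle of the row of three.
data Orient : Set where
  up down left right : Orient

-- A placed T-tetromino: orientation together with the position of the
-- middle square of its row of three.
record Tile : Set where
  constructor tile
  field
    orient : Orient
    centre : Cell
open Tile public

shape : Orient → List Cell
shape up    = (+ 0 , + 0) ∷ (Data.Integer.-_ (+ 1) , + 0) ∷ (+ 1 , + 0) ∷ (+ 0 , + 1) ∷ []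
shape down  = (+ 0 , + 0) ∷ (Data.Integer.-_ (+ 1) , + 0) ∷ (+ 1 , + 0) ∷ (+ 0 , Data.Integer.-_ (+ 1)) ∷ []
shape left  = (+ 0 , + 0) ∷ (+ 0 , Data.Integer.-_ (+ 1)) ∷ (+ 0 , + 1) ∷ (Data.Integer.-_ (+ 1) , + 0) ∷ []
shape right = (+ 0 , + 0) ∷ (+ 0 , Data.Integer.-_ (+ 1)) ∷ (+ 0 , + 1) ∷ (+ 1 , + 0) ∷ []

cells : Tile → List Cell
cells t = map (λ o → centre t ⊕ o) (shape (orient t))

translate : Cell → Tile → Tile
translate v t = tile (orient t) (centre t ⊕ v)

Collection : Set₁
Collection = Tile → Set

NonOverlapping : Collection → Set
NonOverlapping C = ∀ s t → C s → C t → ¬ (s ≡ t) → ∀ z → z ∈ cells s → ¬ (z ∈ cells t)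

-- The horizontal line L is  y = c.  A side of L:
data Side : Set where
  above below : Side

OnSideCell : ℤ → Side → Cell → Set
OnSideCell c above (x , y) = c ≤ y
OnSideCell c below (x , y) = y Data.Integer.< c

OnSide : ℤ → Side → Tile → Set
OnSide c s t = ∀ z → z ∈ cells t → OnSideCell c s z

boundaryRow : ℤ → Side → ℤ
boundaryRow c above = c
boundaryRow c below = c - + 1

CoversConsecutive : ℤ → Side → ℕ → Collection → Set
CoversConsecutive c s B C =
  ∃[ a ] (∀ i → i Data.Nat.< B → ∃[ t ] (C t × ((a + + i , boundaryRow c s) ∈ cells t)))

AP : ℕ → Collection → (ℕ → Tile) → Cell → Set
AP l C T v =
    ( (∀ i → i Data.Nat.< l → C (T i))
    × (∀ i j → i Data.Nat.< l → j Data.Nat.< l → T i ≡ T j → i ≡ j)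
    × (∀ i → suc i Data.Nat.< l → T (suc i) ≡ translate v (T i)) )

HasAP : ℕ → Collection → Set
HasAP l C = ∃[ T ] ∃[ v ] AP l C T v

-- Colour the i-th covered boundary square by its role in a covering tile: the tile's orientation
-- and which of its four squares it is, 16 colours in all.  A tile is determined by one of its squares
-- together with that square's role, so a monochromatic arithmetic progression of boundary squares
-- with difference d yields tiles that are translates of one another by (d, 0).  Hence B can be taken
-- to be the van der Waerden number W(l, 16).  Van der Waerden's theorem is proved by the usual
-- colour-focusing induction, colouring blocks of n consecutive integers by their pattern in Fin (k ^ n).
module Submission where

open import Data.Nat using (ℕ; zero; suc; _+_; _*_; _^_; _≤_; _<_; _<?_; z≤n; s≤s; >-nonZero)
open import Data.Nat.Properties
open import Data.Nat.Tactic.RingSolver using (solve-∀)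
open import Data.Fin using (Fin; zero; suc; combine)
import Data.Fin.Properties as Finₚ
open import Defs
import Data.Integer as ℤ
open import Data.Integer using (ℤ)
import Data.Integer.Properties as ℤₚ
open import Algebra.Properties.AbelianGroup ℤₚ.+-0-abelianGroup using (∙-cancelˡ)
open import Data.Integer.Tactic.RingSolver renaming (solve-∀ to ℤ-solve-∀)
open import Data.List using (lookup)
open import Data.List.Relation.Unary.Any using (index)
open import Data.List.Relation.Unary.Any.Properties using (lookup-index)
open import Data.List.Membership.Propositional using (_∈_)
open import Data.List.Membership.Propositional.Properties using (∈-map⁻)
open import Data.Product using (_×_; Σ; ∃-syntax; _,_; proj₁; proj₂)
open import Data.Sum using (_⊎_; inj₁; inj₂; [_,_])
open import Data.Empty using (⊥-elim)
open import Function using (_∘_; id)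
open import Function.Definitions using (Injective)
open import Relation.Binary.PropositionalEquality using (_≡_; _≢_; refl; sym; trans; cong; cong₂; subst; module ≡-Reasoning)
open import Relation.Nullary using (yes; no; contradiction)

record MonochromaticAP {A : Set} (f : ℕ → A) (l N : ℕ) : Set where
  field
    start step    : ℕ
    step≥1        : 1 ≤ step
    bounded       : ∀ i → i < l → start + i * step < N
    monochromatic : ∀ i → i < l → f (start + i * step) ≡ f start

VanDerWaerden : ℕ → ℕ → Set
VanDerWaerden l k = ∃[ N ] ∀ (f : ℕ → Fin k) → MonochromaticAP f l N

vanDerWaerden-1 : ∀ k → VanDerWaerden 1 k
vanDerWaerden-1 k = 1 , λ f → record
  { start = 0 ; step = 1 ; step≥1 = ≤-refl
  ; bounded = λ { zero _ → s≤s z≤n ; (suc i) (s≤s ()) }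
  ; monochromatic = λ { zero _ → refl ; (suc i) (s≤s ()) } }

module _ {A : Set} {f : ℕ → A} {l : ℕ} where

  MonochromaticAP-shift : ∀ s {n N} → s + n ≤ N → MonochromaticAP (λ x → f (s + x)) l n → MonochromaticAP f l N
  MonochromaticAP-shift s {N = N} s+n≤N P = record
    { start = s + start ; step = step ; step≥1 = step≥1
    ; bounded = λ i i<l → subst (_< N) (sym (+-assoc s start (i * step)))
                            (≤-trans (+-monoʳ-< s (bounded i i<l)) s+n≤N)
    ; monochromatic = λ i i<l → subst (λ z → f z ≡ f (s + start)) (sym (+-assoc s start (i * step)))
                                  (monochromatic i i<l) }
    where open MonochromaticAP P

  MonochromaticAP-injective : ∀ {B : Set} {g : A → B} {N} → Injective _≡_ _≡_ g →
                              MonochromaticAP (g ∘ f) l N → MonochromaticAP f l N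
  MonochromaticAP-injective g-inj P = record
    { start = start ; step = step ; step≥1 = step≥1 ; bounded = bounded
    ; monochromatic = λ i i<l → g-inj (monochromatic i i<l) }
    where open MonochromaticAP P

m+n<2*o : ∀ {m n o} → m < o → n ≤ o → m + n < 2 * o
m+n<2*o {m} {n} {o} m<o n≤o = subst (m + n <_) (cong (o +_) (sym (+-identityʳ o))) (+-mono-<-≤ m<o n≤o)

-- An AP of length 1 has an arbitrary step, so it is first reset to step 1.
nextTerm-bounded : ∀ {A : Set} {f : ℕ → A} {L M} → 1 ≤ L → MonochromaticAP f L M →
                   Σ (MonochromaticAP f L M) λ P → MonochromaticAP.start P + L * MonochromaticAP.step P < 2 * M
nextTerm-bounded {f = f} {suc zero} {M} _ P = P′ , m+n<2*o start<M (≤-trans (s≤s z≤n) start<M)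
  where
  open MonochromaticAP P
  start<M : start < M
  start<M = subst (_< M) (+-identityʳ start) (bounded 0 (s≤s z≤n))
  P′ : MonochromaticAP f 1 M
  P′ = record
    { start = start ; step = 1 ; step≥1 = ≤-refl
    ; bounded = λ { zero _ → bounded 0 (s≤s z≤n) ; (suc i) (s≤s ()) }
    ; monochromatic = λ { zero _ → cong f (+-identityʳ start) ; (suc i) (s≤s ()) } }
nextTerm-bounded {L = suc (suc l)} {M} _ P =
  P , subst (_< 2 * M) (sym (split-last start l step)) (m+n<2*o (bounded (suc l) ≤-refl) step≤M)
  where
  open MonochromaticAP P
  split-last : ∀ a l d → a + suc (suc l) * d ≡ (a + suc l * d) + d
  split-last = solve-∀
  second<M : start + step < M
  second<M = subst (λ x → start + x < M) (*-identityˡ step) (bounded 1 (s≤s (s≤s z≤n)))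
  step≤M : step ≤ M
  step≤M = <⇒≤ (≤-<-trans (m≤n+m step start) second<M)

encodePrefix : ∀ {k} n → (ℕ → Fin k) → Fin (k ^ n)
encodePrefix zero    g = zero
encodePrefix (suc n) g = combine (g 0) (encodePrefix n (g ∘ suc))

encodePrefix-injective : ∀ {k} n {g h : ℕ → Fin k} → encodePrefix n g ≡ encodePrefix n h →
                         ∀ x → x < n → g x ≡ h x
encodePrefix-injective (suc n) {g} {h} eq x x<n with Finₚ.combine-injective (g 0) _ (h 0) _ eq
encodePrefix-injective (suc n) eq zero    _         | g0≡h0 , _    = g0≡h0
encodePrefix-injective (suc n) eq (suc x) (s≤s x<n) | _     , rest = encodePrefix-injective n rest x x<n

record Focused {k} (f : ℕ → Fin k) (L N r : ℕ) : Set where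
  field
    focus       : ℕ
    focus<N     : focus < N
    start step  : Fin r → ℕ
    colour      : Fin r → Fin k
    step≥1      : ∀ j → 1 ≤ step j
    focused     : ∀ j → start j + L * step j ≡ focus
    coloured    : ∀ j i → i < L → f (start j + i * step j) ≡ colour j
    colour-injective : Injective _≡_ _≡_ colour

module _ {k} {f : ℕ → Fin k} {L N r} (F : Focused f L N r) where
  open Focused F

  Focused-term< : ∀ j i → i < L → start j + i * step j < N
  Focused-term< j i i<L = <-≤-trans (+-monoʳ-< (start j) (*-monoˡ-< (step j) {{>-nonZero (step≥1 j)}} i<L))
                                     (≤-trans (≤-reflexive (focused j)) (<⇒≤ focus<N))

  Focused-complete : 1 ≤ L → ∀ j → f focus ≡ colour j → MonochromaticAP f (suc L) N
  Focused-complete L≥1 j f-focus = record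
    { start = start j ; step = step j ; step≥1 = step≥1 j ; bounded = bounded ; monochromatic = mono }
    where
    start-coloured : f (start j) ≡ colour j
    start-coloured = subst (λ z → f z ≡ colour j) (+-identityʳ (start j)) (coloured j 0 L≥1)
    bounded : ∀ i → i < suc L → start j + i * step j < N
    bounded i (s≤s i≤L) with m≤n⇒m<n∨m≡n i≤L
    ... | inj₁ i<L  = Focused-term< j i i<L
    ... | inj₂ refl = subst (_< N) (sym (focused j)) focus<N
    mono : ∀ i → i < suc L → f (start j + i * step j) ≡ f (start j)
    mono i (s≤s i≤L) with m≤n⇒m<n∨m≡n i≤L
    ... | inj₁ i<L  = trans (coloured j i i<L) (sym start-coloured)
    ... | inj₂ refl = trans (trans (cong f (focused j)) f-focus) (sym start-coloured)

-- With k distinct colours every colour is used, in particular that of the focus.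
Focused-saturated : ∀ {k} {f : ℕ → Fin k} {L N} → 1 ≤ L → Focused f L N k → MonochromaticAP f (suc L) N
Focused-saturated {k} {f} L≥1 F with Finₚ.pigeonhole ≤-refl (λ { zero → f focus ; (suc j) → colour j })
  where open Focused F
... | zero  , suc j , _   , f-focus = Focused-complete F L≥1 j f-focus
... | suc i , suc j , i<j , same    = ⊥-elim (Finₚ.<-irrefl (cong suc (Focused.colour-injective F same)) i<j)

-- Adding the period e to every step keeps the old APs focused (at the focus L periods later),
-- and the focus itself, repeated with period e, is one more AP in a new colour.
Focused-extend : ∀ {k} {f : ℕ → Fin k} {L n N r} s e → 1 ≤ e →
                 (∀ i x → i < L → x < n → f (s + x + i * e) ≡ f (s + x)) →
                 (F : Focused (λ x → f (s + x)) L n r) →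
                 (∀ j → f (s + Focused.focus F) ≢ Focused.colour F j) →
                 s + Focused.focus F + L * e < N →
                 Focused f L N (suc r)
Focused-extend {k} {f} {L} {n} {N} {r} s e e≥1 periodic F new-colour next<N = record
  { focus = s + focus + L * e ; focus<N = next<N
  ; start = start′ ; step = step′ ; colour = colour′ ; step≥1 = step′≥1
  ; focused = focused′ ; coloured = coloured′ ; colour-injective = colour′-injective }
  where
  open Focused F
  start′ step′ : Fin (suc r) → ℕ
  start′ zero    = s + focus
  start′ (suc j) = s + start j
  step′ zero    = e
  step′ (suc j) = step j + e
  colour′ : Fin (suc r) → Fin k
  colour′ zero    = f (s + focus)
  colour′ (suc j) = colour j
  step′≥1 : ∀ j → 1 ≤ step′ j
  step′≥1 zero    = e≥1
  step′≥1 (suc j) = ≤-trans (step≥1 j) (m≤m+n (step j) e)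
  regroup : ∀ s a i d e → s + a + i * (d + e) ≡ s + (a + i * d) + i * e
  regroup = solve-∀
  focused′ : ∀ j → start′ j + L * step′ j ≡ s + focus + L * e
  focused′ zero    = refl
  focused′ (suc j) = trans (regroup s (start j) L (step j) e) (cong (λ z → s + z + L * e) (focused j))
  coloured′ : ∀ j i → i < L → f (start′ j + i * step′ j) ≡ colour′ j
  coloured′ zero    i i<L = periodic i focus i<L focus<N
  coloured′ (suc j) i i<L = begin
    f (s + start j + i * (step j + e))     ≡⟨ cong f (regroup s (start j) i (step j) e) ⟩
    f (s + (start j + i * step j) + i * e) ≡⟨ periodic i _ i<L (Focused-term< F j i i<L) ⟩
    f (s + (start j + i * step j))         ≡⟨ coloured j i i<L ⟩
    colour j                               ∎
    where open ≡-Reasoning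
  colour′-injective : Injective _≡_ _≡_ colour′
  colour′-injective {zero}  {zero}  _    = refl
  colour′-injective {zero}  {suc j} same = ⊥-elim (new-colour j same)
  colour′-injective {suc i} {zero}  same = ⊥-elim (new-colour i (sym same))
  colour′-injective {suc i} {suc j} same = cong suc (colour-injective same)

liftFromBlock : ∀ {k} {f : ℕ → Fin k} {L n M r} b D → 1 ≤ L → 1 ≤ D → b + L * D < 2 * M →
                (∀ i x → i < L → x < n → f ((b + i * D) * n + x) ≡ f (b * n + x)) →
                MonochromaticAP (λ x → f (b * n + x)) (suc L) n ⊎ Focused (λ x → f (b * n + x)) L n r →
                MonochromaticAP f (suc L) (2 * M * n) ⊎ Focused f L (2 * M * n) (suc r)
liftFromBlock {f = f} {L} {n} {M} b D L≥1 D≥1 next<2M alike = [ inj₁ ∘ shift , extendOrComplete ]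
  where
  block-fits : b * n + n ≤ 2 * M * n
  block-fits = ≤-trans (≤-reflexive (+-comm (b * n) n)) (*-monoˡ-≤ n (≤-<-trans (m≤m+n b (L * D)) next<2M))
  shift : MonochromaticAP (λ x → f (b * n + x)) (suc L) n → MonochromaticAP f (suc L) (2 * M * n)
  shift = MonochromaticAP-shift (b * n) block-fits
  extendOrComplete : ∀ {r} → Focused (λ x → f (b * n + x)) L n r →
                     MonochromaticAP f (suc L) (2 * M * n) ⊎ Focused f L (2 * M * n) (suc r)
  extendOrComplete F with Finₚ.any? (λ j → f (b * n + focus) Finₚ.≟ colour j)
    where open Focused F
  ... | yes (j , f-focus) = inj₁ (shift (Focused-complete F L≥1 j f-focus))
  ... | no  new-colour    =
    inj₂ (Focused-extend (b * n) (D * n) (*-mono-≤ D≥1 n≥1) periodic F (λ j → new-colour ∘ (j ,_)) next<N)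
    where
    open Focused F
    n≥1 : 1 ≤ n
    n≥1 = ≤-<-trans z≤n focus<N
    regroup : ∀ b n x i D → b * n + x + i * (D * n) ≡ (b + i * D) * n + x
    regroup = solve-∀
    periodic : ∀ i x → i < L → x < n → f (b * n + x + i * (D * n)) ≡ f (b * n + x)
    periodic i x i<L x<n = trans (cong f (regroup b n x i D)) (alike i x i<L x<n)
    next<N : b * n + focus + L * (D * n) < 2 * M * n
    next<N = begin-strict
      b * n + focus + L * (D * n) ≡⟨ regroup b n focus L D ⟩
      (b + L * D) * n + focus     <⟨ +-monoʳ-< _ focus<N ⟩
      (b + L * D) * n + n         ≡⟨ +-comm _ n ⟩
      suc (b + L * D) * n         ≤⟨ *-monoˡ-≤ n next<2M ⟩
      2 * M * n                   ∎
      where open ≤-Reasoning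

focusing : ∀ {k} L → 1 ≤ L → (∀ k′ → VanDerWaerden L k′) → ∀ r →
           ∃[ N ] ∀ (f : ℕ → Fin k) → MonochromaticAP f (suc L) N ⊎ Focused f L N r
focusing L L≥1 vdw zero = 1 , λ f → inj₂ (record
  { focus = 0 ; focus<N = s≤s z≤n ; start = λ () ; step = λ () ; colour = λ ()
  ; step≥1 = λ () ; focused = λ () ; coloured = λ () ; colour-injective = λ { {()} } })
focusing {k} L L≥1 vdw (suc r) with focusing {k} L L≥1 vdw r
... | n , inside-block with vdw (k ^ n)
... | M , blocks-vdw = 2 * M * n , λ f →
  let blockColour = λ b → encodePrefix n (λ x → f (b * n + x))
      P , next<2M = nextTerm-bounded L≥1 (blocks-vdw blockColour)
      open MonochromaticAP P
  in liftFromBlock {M = M} start step L≥1 step≥1 next<2M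
       (λ i x i<L → encodePrefix-injective n (monochromatic i i<L) x)
       (inside-block (λ x → f (start * n + x)))

vanDerWaerden : ∀ l k → VanDerWaerden (suc l) k
vanDerWaerden zero    k = vanDerWaerden-1 k
vanDerWaerden (suc l) k with focusing {k} (suc l) (s≤s z≤n) (vanDerWaerden l) k
... | N , ap-or-focused = N , λ f → [ id , Focused-saturated (s≤s z≤n) ] (ap-or-focused f)

-- The role of a square in a tile: the tile's orientation and the square's index in its `shape`.
Role : Set
Role = Orient × Fin 4

offset : Orient → Fin 4 → Cell
offset up    = lookup (shape up)
offset down  = lookup (shape down)
offset left  = lookup (shape left)
offset right = lookup (shape right)

squareIndex : ∀ o {u} → u ∈ shape o → Fin 4
squareIndex up    = index
squareIndex down  = index
squareIndex left  = index
squareIndex right = index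

offset-squareIndex : ∀ o {u} (u∈ : u ∈ shape o) → u ≡ offset o (squareIndex o u∈)
offset-squareIndex up    = lookup-index
offset-squareIndex down  = lookup-index
offset-squareIndex left  = lookup-index
offset-squareIndex right = lookup-index

orientCode : Orient → Fin 4
orientCode up    = zero
orientCode down  = suc zero
orientCode left  = suc (suc zero)
orientCode right = suc (suc (suc zero))

orientDecode : Fin 4 → Orient
orientDecode zero                = up
orientDecode (suc zero)          = down
orientDecode (suc (suc zero))    = left
orientDecode (suc (suc (suc _))) = right

orientDecode-orientCode : ∀ o → orientDecode (orientCode o) ≡ o
orientDecode-orientCode up    = refl
orientDecode-orientCode down  = refl
orientDecode-orientCode left  = refl
orientDecode-orientCode right = refl

roleCode : Role → Fin 16
roleCode (o , i) = combine (orientCode o) i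

roleCode-injective : Injective _≡_ _≡_ roleCode
roleCode-injective {o , i} {o′ , i′} same with Finₚ.combine-injective (orientCode o) i (orientCode o′) i′ same
... | same-orient , refl = cong (_, i) (begin
  o                            ≡⟨ sym (orientDecode-orientCode o) ⟩
  orientDecode (orientCode o)  ≡⟨ cong orientDecode same-orient ⟩
  orientDecode (orientCode o′) ≡⟨ orientDecode-orientCode o′ ⟩
  o′                           ∎)
  where open ≡-Reasoning

_⊖_ : Cell → Cell → Cell
(a , b) ⊖ (c , d) = (a ℤ.- c , b ℤ.- d)

⊕-⊖-cancel : ∀ z u → (z ⊕ u) ⊖ u ≡ z
⊕-⊖-cancel (a , b) (c , d) = cong₂ _,_ (cancel a c) (cancel b d)
  where
  cancel : ∀ a c → a ℤ.+ c ℤ.- c ≡ a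
  cancel = ℤ-solve-∀

⊖-⊕-cancel : ∀ z u → (z ⊖ u) ⊕ u ≡ z
⊖-⊕-cancel (a , b) (c , d) = cong₂ _,_ (cancel a c) (cancel b d)
  where
  cancel : ∀ a c → a ℤ.- c ℤ.+ c ≡ a
  cancel = ℤ-solve-∀

⊕-⊖-comm : ∀ z u v → (z ⊕ v) ⊖ u ≡ (z ⊖ u) ⊕ v
⊕-⊖-comm (a , b) (c , d) (e , f) = cong₂ _,_ (comm a c e) (comm b d f)
  where
  comm : ∀ a c e → a ℤ.+ e ℤ.- c ≡ a ℤ.- c ℤ.+ e
  comm = ℤ-solve-∀

placeAt : Role → Cell → Tile
placeAt (o , i) z = tile o (z ⊖ offset o i)

placeAt-⊕ : ∀ ρ z v → placeAt ρ (z ⊕ v) ≡ translate v (placeAt ρ z)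
placeAt-⊕ (o , i) z v = cong (tile o) (⊕-⊖-comm z (offset o i) v)

placeAt-injective : ∀ ρ {z z′} → placeAt ρ z ≡ placeAt ρ z′ → z ≡ z′
placeAt-injective (o , i) {z} {z′} same = begin
  z                                 ≡⟨ sym (⊖-⊕-cancel z (offset o i)) ⟩
  (z ⊖ offset o i) ⊕ offset o i     ≡⟨ cong (λ c → c ⊕ offset o i) (cong centre same) ⟩
  (z′ ⊖ offset o i) ⊕ offset o i    ≡⟨ ⊖-⊕-cancel z′ (offset o i) ⟩
  z′                                ∎
  where open ≡-Reasoning

roleOf : ∀ t {z} → z ∈ cells t → Role
roleOf (tile o c) z∈ = o , squareIndex o (proj₁ (proj₂ (∈-map⁻ (c ⊕_) z∈)))

placeAt-roleOf : ∀ t {z} (z∈ : z ∈ cells t) → t ≡ placeAt (roleOf t z∈) z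
placeAt-roleOf (tile o c) z∈ with ∈-map⁻ (c ⊕_) z∈
... | u , u∈ , refl = cong (tile o) (begin
  c                                      ≡⟨ sym (⊕-⊖-cancel c u) ⟩
  (c ⊕ u) ⊖ u                            ≡⟨ cong ((c ⊕ u) ⊖_) (offset-squareIndex o u∈) ⟩
  (c ⊕ u) ⊖ offset o (squareIndex o u∈) ∎)
  where open ≡-Reasoning

module BoundaryCover (C : Collection) (a row : ℤ) {N : ℕ}
  (cover : ∀ i → i < N → ∃[ t ] (C t × ((a ℤ.+ ℤ.+ i , row) ∈ cells t))) where

  square : ℕ → Cell
  square i = (a ℤ.+ ℤ.+ i , row)

  square-+ : ∀ m n → square (m + n) ≡ square m ⊕ (ℤ.+ n , ℤ.+ 0)
  square-+ m n = cong₂ _,_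
    (trans (cong (λ w → a ℤ.+ w) (ℤₚ.pos-+ m n)) (sym (ℤₚ.+-assoc a (ℤ.+ m) (ℤ.+ n))))
    (sym (ℤₚ.+-identityʳ row))

  square-injective : ∀ {m n} → square m ≡ square n → m ≡ n
  square-injective same = ℤₚ.+-injective (∙-cancelˡ a _ _ (cong proj₁ same))

  -- Squares outside the covered range get an arbitrary role.
  role : ℕ → Role
  role i with i <? N
  ... | yes i<N = let t , _ , sq∈t = cover i i<N in roleOf t sq∈t
  ... | no  _   = up , zero

  covered : ∀ i → i < N → C (placeAt (role i) (square i))
  covered i i<N with i <? N
  ... | yes i<N′ = let t , t∈C , sq∈t = cover i i<N′ in subst C (placeAt-roleOf t sq∈t) t∈C
  ... | no  i≮N  = contradiction i<N i≮N

  monochromatic⇒HasAP : ∀ {l} → MonochromaticAP role l N → HasAP l C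
  monochromatic⇒HasAP {l} P = T , (ℤ.+ step , ℤ.+ 0) , inC , distinct , translated
    where
    open MonochromaticAP P
    term : ℕ → ℕ
    term j = start + j * step
    ρ : Role
    ρ = role start
    v : Cell
    v = (ℤ.+ step , ℤ.+ 0)
    T : ℕ → Tile
    T j = placeAt ρ (square (term j))
    inC : ∀ j → j < l → C (T j)
    inC j j<l = subst (λ ρ′ → C (placeAt ρ′ (square (term j)))) (monochromatic j j<l) (covered _ (bounded j j<l))
    distinct : ∀ i j → i < l → j < l → T i ≡ T j → i ≡ j
    distinct i j _ _ same = *-cancelʳ-≡ i j step {{>-nonZero step≥1}}
      (+-cancelˡ-≡ start _ _ (square-injective (placeAt-injective ρ same)))
    term-suc : ∀ j → term (suc j) ≡ term j + step
    term-suc j = trans (cong (start +_) (+-comm step (j * step))) (sym (+-assoc start (j * step) step))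
    translated : ∀ j → suc j < l → T (suc j) ≡ translate v (T j)
    translated j _ = begin
      placeAt ρ (square (term (suc j)))  ≡⟨ cong (placeAt ρ ∘ square) (term-suc j) ⟩
      placeAt ρ (square (term j + step)) ≡⟨ cong (placeAt ρ) (square-+ (term j) step) ⟩
      placeAt ρ (square (term j) ⊕ v)    ≡⟨ placeAt-⊕ ρ (square (term j)) v ⟩
      translate v (T j)                  ∎
      where open ≡-Reasoning

theorem2 : ∀ (l : ℕ) → 1 ≤ l → ∃[ B ] (∀ (c : ℤ) (s : Side) (C : Collection) → NonOverlapping C → (∀ t → C t → OnSide c s t) → CoversConsecutive c s B C → HasAP l C)
theorem2 zero    ()
theorem2 (suc l) _ with vanDerWaerden l 16
... | N , vdw = N , λ c s C _ _ (a , cover) →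
  let open BoundaryCover C a (boundaryRow c s) cover
  in monochromatic⇒HasAP (MonochromaticAP-injective roleCode-injective (vdw (roleCode ∘ role)))
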